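{- Let $G$ be a graph on $n$ vertices with minimum degree $\delta(G)>\frac{4n}{5}$. If $A,B\subseteq V(G)$ with $A\neq\emptyset$, $B\neq\emptyset$ and $|A\cup B|\leqslant5$, then $\widehat N(A)+\widehat N(B)-\widehat N(A\cap B)>0$.
   Context: For $S\subseteq V(G)$, the common neighbor density is $\widehat N(S)=\frac{1}{n}\big|V(G)\setminus\bigcup_{s\in S}(V(G)\setminus N(s))\big|$; thus $\widehat N(\emptyset)=1$ and for $S\neq\emptyset$, $\widehat N(S)=\frac{|\bigcap_{s\in S}N(s)|}{n}$, where $N(s)$ is the neighborhood of $s$. -}

module Defs where

open import Data.Nat using (ℕ)
open import Data.Bool using (Bool; if_then_else_)
open import Data.Fin using (Fin)
open import Data.Fin.Subset using (Subset; ∁; _∪_; ⊥; ∣_∣)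
open import Data.List using (List; foldr)
open import Data.List using () renaming (allFin to allFinL)
open import Data.Vec using (tabulate; lookup)
open import Relation.Binary using (Decidable; Symmetric; Irreflexive)
open import Relation.Binary.PropositionalEquality using (_≡_)
open import Relation.Nullary using (does)
open import Level using (0ℓ)

record Graph (n : ℕ) : Set₁ where
  field
    Adj   : Fin n → Fin n → Set
    adj?  : Decidable Adj
    sym   : Symmetric Adj
    irrefl : Irreflexive _≡_ Adj

module _ {n : ℕ} (G : Graph n) where
  open Graph G

  N : Fin n → Subset n
  N v = tabulate (λ w → does (adj? v w))

  degree : Fin n → ℕ
  degree v = ∣ N v ∣

  MinDegGt4n/5 : Set
  MinDegGt4n/5 = ∀ v → 4 Data.Nat.* n Data.Nat.< 5 Data.Nat.* degree v

  -- V(G) \ ⋃_{s ∈ S} (V(G) \ N(s))   (the common neighbourhood; = V(G) for S = ∅)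
  commonNbhd : Subset n → Subset n
  commonNbhd S =
    ∁ (foldr (λ s acc → (if lookup S s then ∁ (N s) else ⊥) ∪ acc) ⊥ (allFinL n))

  -- n · N̂(S) = |V(G) \ ⋃_{s∈S} (V(G) \ N(s))|
  nNhat : Subset n → ℕ
  nNhat S = ∣ commonNbhd S ∣

-- Write U(S) for the set of vertices missed by some s ∈ S, so that
-- n·N̂(S) = n − |U(S)|.  Since U(A) = U(A ∩ B) ∪ U(A ∖ B), the claim
-- |U(A)| + |U(B)| < n + |U(A ∩ B)| follows from the union bound
-- |U(A ∖ B)| + |U(B)| ≤ Σ_{s ∈ A ∪ B} (n − deg s), and each of the at most
-- five summands is below n/5.
module Submission where

open import Defs
open import Data.Nat using (ℕ; _+_; _<_; _≤_)
open import Data.Fin.Subset using (Subset; Nonempty; _∩_; _∪_; ∣_∣)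

open import Algebra.Bundles using (CommutativeMonoid)
import Algebra.Properties.CommutativeSemigroup
import Algebra.Properties.IdempotentCommutativeMonoid
open import Data.Bool using (if_then_else_)
open import Data.Fin using (Fin; zero; suc)
open import Data.Fin.Subset using (inside; outside; ⊥; ⊤; ∁)
open import Data.Fin.Subset.Properties
  using (∣∁p∣≡n∸∣p∣; ∣p∣≤n; ∣⊥∣≡0; p∪∁p≡⊤; ∩-distribˡ-∪; ∩-identityʳ;
         ∪-assoc; ∪-identityˡ; ∪-idempotentCommutativeMonoid; ∪-commutativeMonoid; x∈p∪q⁺)
open import Data.List using (foldr; map; tabulate) renaming (allFin to allFinL)
open import Data.List.Properties using (foldr-map; map-tabulate)
open import Data.Nat using (_*_; z≤n; s≤s)
import Data.Nat as Nat
open import Data.Nat.Properties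
open import Data.Product using (_,_)
open import Data.Sum using (inj₁)
open import Data.Vec using (_∷_; []; lookup; there)
open import Function using (_∘_; id; const)
open import Relation.Binary.PropositionalEquality

private module +-CS = Algebra.Properties.CommutativeSemigroup +-commutativeSemigroup

∣p∪q∣≤∣p∣+∣q∣ : ∀ {n} (p q : Subset n) → ∣ p ∪ q ∣ ≤ ∣ p ∣ + ∣ q ∣
∣p∪q∣≤∣p∣+∣q∣ []            []            = z≤n
∣p∪q∣≤∣p∣+∣q∣ (inside  ∷ p) (inside  ∷ q) =
  s≤s (≤-trans (∣p∪q∣≤∣p∣+∣q∣ p q) (+-monoʳ-≤ ∣ p ∣ (n≤1+n ∣ q ∣)))
∣p∪q∣≤∣p∣+∣q∣ (inside  ∷ p) (outside ∷ q) = s≤s (∣p∪q∣≤∣p∣+∣q∣ p q)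
∣p∪q∣≤∣p∣+∣q∣ (outside ∷ p) (inside  ∷ q) =
  ≤-trans (s≤s (∣p∪q∣≤∣p∣+∣q∣ p q)) (≤-reflexive (sym (+-suc ∣ p ∣ ∣ q ∣)))
∣p∪q∣≤∣p∣+∣q∣ (outside ∷ p) (outside ∷ q) = ∣p∪q∣≤∣p∣+∣q∣ p q

∣∁p∣+∣p∣≡n : ∀ {n} (p : Subset n) → ∣ ∁ p ∣ + ∣ p ∣ ≡ n
∣∁p∣+∣p∣≡n p = trans (cong (_+ ∣ p ∣) (∣∁p∣≡n∸∣p∣ p)) (m∸n+n≡m (∣p∣≤n p))

p≡p∩q∪p∩∁q : ∀ {n} (p q : Subset n) → p ≡ (p ∩ q) ∪ (p ∩ ∁ q)
p≡p∩q∪p∩∁q p q = begin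
  p                     ≡⟨ ∩-identityʳ p ⟨
  p ∩ ⊤                 ≡⟨ cong (p ∩_) (p∪∁p≡⊤ q) ⟨
  p ∩ (q ∪ ∁ q)         ≡⟨ ∩-distribˡ-∪ p q (∁ q) ⟩
  (p ∩ q) ∪ (p ∩ ∁ q)   ∎
  where open ≡-Reasoning

∑[_]_ : ∀ {n} → Subset n → (Fin n → ℕ) → ℕ
∑[ []          ] f = 0
∑[ inside  ∷ p ] f = f zero + ∑[ p ] (f ∘ suc)
∑[ outside ∷ p ] f = ∑[ p ] (f ∘ suc)

∑-const : ∀ {n} (p : Subset n) b → ∑[ p ] const b ≡ ∣ p ∣ * b
∑-const []            b = refl
∑-const (inside  ∷ p) b = cong (b +_) (∑-const p b)
∑-const (outside ∷ p) b = ∑-const p b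

*-distribˡ-∑ : ∀ {n} c (p : Subset n) f → c * ∑[ p ] f ≡ ∑[ p ] (λ i → c * f i)
*-distribˡ-∑ c []            f = *-zeroʳ c
*-distribˡ-∑ c (inside  ∷ p) f =
  trans (*-distribˡ-+ c (f zero) _) (cong (c * f zero +_) (*-distribˡ-∑ c p (f ∘ suc)))
*-distribˡ-∑ c (outside ∷ p) f = *-distribˡ-∑ c p (f ∘ suc)

∑-mono-≤ : ∀ {n} (p : Subset n) {f g} → (∀ i → f i ≤ g i) → ∑[ p ] f ≤ ∑[ p ] g
∑-mono-≤ []            f≤g = z≤n
∑-mono-≤ (inside  ∷ p) f≤g = +-mono-≤ (f≤g zero) (∑-mono-≤ p (f≤g ∘ suc))
∑-mono-≤ (outside ∷ p) f≤g = ∑-mono-≤ p (f≤g ∘ suc)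

∑-mono-< : ∀ {n} (p : Subset n) {f g} → Nonempty p → (∀ i → f i < g i) → ∑[ p ] f < ∑[ p ] g
∑-mono-< (inside  ∷ p) _                   f<g = +-mono-<-≤ (f<g zero) (∑-mono-≤ p (<⇒≤ ∘ f<g ∘ suc))
∑-mono-< (outside ∷ p) (suc i , there i∈p) f<g = ∑-mono-< p (i , i∈p) (f<g ∘ suc)

∑[p∩∁q]+∑[q]≡∑[p∪q] : ∀ {n} (p q : Subset n) f → ∑[ p ∩ ∁ q ] f + ∑[ q ] f ≡ ∑[ p ∪ q ] f
∑[p∩∁q]+∑[q]≡∑[p∪q] []            []            f = refl
∑[p∩∁q]+∑[q]≡∑[p∪q] (inside  ∷ p) (outside ∷ q) f =
  trans (+-assoc (f zero) _ _) (cong (f zero +_) (∑[p∩∁q]+∑[q]≡∑[p∪q] p q (f ∘ suc)))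
∑[p∩∁q]+∑[q]≡∑[p∪q] (outside ∷ p) (outside ∷ q) f = ∑[p∩∁q]+∑[q]≡∑[p∪q] p q (f ∘ suc)
∑[p∩∁q]+∑[q]≡∑[p∪q] (inside  ∷ p) (inside  ∷ q) f =
  trans (+-CS.x∙yz≈y∙xz (∑[ p ∩ ∁ q ] (f ∘ suc)) (f zero) (∑[ q ] (f ∘ suc)))
        (cong (f zero +_) (∑[p∩∁q]+∑[q]≡∑[p∪q] p q (f ∘ suc)))
∑[p∩∁q]+∑[q]≡∑[p∪q] (outside ∷ p) (inside  ∷ q) f =
  trans (+-CS.x∙yz≈y∙xz (∑[ p ∩ ∁ q ] (f ∘ suc)) (f zero) (∑[ q ] (f ∘ suc)))
        (cong (f zero +_) (∑[p∩∁q]+∑[q]≡∑[p∪q] p q (f ∘ suc)))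

module _ {m : ℕ} where
  private
    module ∪-CS = Algebra.Properties.CommutativeSemigroup
      (CommutativeMonoid.commutativeSemigroup (∪-commutativeMonoid m))
    module ∪-ICM = Algebra.Properties.IdempotentCommutativeMonoid
      (∪-idempotentCommutativeMonoid m)

  ⋃[_]_ : ∀ {n} → Subset n → (Fin n → Subset m) → Subset m
  ⋃[ []          ] X = ⊥
  ⋃[ inside  ∷ p ] X = X zero ∪ ⋃[ p ] (X ∘ suc)
  ⋃[ outside ∷ p ] X = ⋃[ p ] (X ∘ suc)

  foldr-allFin≡⋃ : ∀ {n} (p : Subset n) (X : Fin n → Subset m) →
    foldr (λ i acc → (if lookup p i then X i else ⊥) ∪ acc) ⊥ (allFinL n) ≡ ⋃[ p ] X
  foldr-allFin≡⋃ []                  X = refl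
  foldr-allFin≡⋃ {Nat.suc n} (s ∷ p) X = begin
    F zero (foldr F ⊥ (tabulate suc))         ≡⟨ cong (F zero ∘ foldr F ⊥) (map-tabulate id suc) ⟨
    F zero (foldr F ⊥ (map suc (allFinL n)))  ≡⟨ cong (F zero) (foldr-map F suc ⊥ (allFinL n)) ⟩
    F zero (foldr (F ∘ suc) ⊥ (allFinL n))    ≡⟨ cong (F zero) (foldr-allFin≡⋃ p (X ∘ suc)) ⟩
    F zero (⋃[ p ] (X ∘ suc))                 ≡⟨ ⋃-∷ s ⟩
    ⋃[ s ∷ p ] X                              ∎
    where
    open ≡-Reasoning
    F : Fin (Nat.suc n) → Subset m → Subset m
    F i acc = (if lookup (s ∷ p) i then X i else ⊥) ∪ acc
    ⋃-∷ : ∀ s → (if s then X zero else ⊥) ∪ ⋃[ p ] (X ∘ suc) ≡ ⋃[ s ∷ p ] X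
    ⋃-∷ inside  = refl
    ⋃-∷ outside = ∪-identityˡ _

  ⋃-∪ : ∀ {n} (p q : Subset n) (X : Fin n → Subset m) → ⋃[ p ∪ q ] X ≡ ⋃[ p ] X ∪ ⋃[ q ] X
  ⋃-∪ []            []            X = sym (∪-identityˡ ⊥)
  ⋃-∪ (inside  ∷ p) (inside  ∷ q) X =
    trans (cong (X zero ∪_) (⋃-∪ p q (X ∘ suc))) (∪-ICM.∙-distrˡ-∙ (X zero) _ _)
  ⋃-∪ (inside  ∷ p) (outside ∷ q) X =
    trans (cong (X zero ∪_) (⋃-∪ p q (X ∘ suc))) (sym (∪-assoc (X zero) _ _))
  ⋃-∪ (outside ∷ p) (inside  ∷ q) X =
    trans (cong (X zero ∪_) (⋃-∪ p q (X ∘ suc))) (sym (∪-CS.x∙yz≈y∙xz _ (X zero) _))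
  ⋃-∪ (outside ∷ p) (outside ∷ q) X = ⋃-∪ p q (X ∘ suc)

  ∣⋃∣≤∑∣∣ : ∀ {n} (p : Subset n) (X : Fin n → Subset m) → ∣ ⋃[ p ] X ∣ ≤ ∑[ p ] (∣_∣ ∘ X)
  ∣⋃∣≤∑∣∣ []            X = ≤-reflexive (∣⊥∣≡0 m)
  ∣⋃∣≤∑∣∣ (inside  ∷ p) X =
    ≤-trans (∣p∪q∣≤∣p∣+∣q∣ (X zero) _) (+-monoʳ-≤ ∣ X zero ∣ (∣⋃∣≤∑∣∣ p (X ∘ suc)))
  ∣⋃∣≤∑∣∣ (outside ∷ p) X = ∣⋃∣≤∑∣∣ p (X ∘ suc)

  ∣⋃[p]∣+∣⋃[q]∣≤∣⋃[p∩q]∣+∑[p∪q] : ∀ {n} (p q : Subset n) (X : Fin n → Subset m) →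
    ∣ ⋃[ p ] X ∣ + ∣ ⋃[ q ] X ∣ ≤ ∣ ⋃[ p ∩ q ] X ∣ + ∑[ p ∪ q ] (∣_∣ ∘ X)
  ∣⋃[p]∣+∣⋃[q]∣≤∣⋃[p∩q]∣+∑[p∪q] p q X = begin
    ∣ ⋃[ p ] X ∣ + ∣ ⋃[ q ] X ∣
      ≡⟨ cong (λ r → ∣ ⋃[ r ] X ∣ + ∣ ⋃[ q ] X ∣) (p≡p∩q∪p∩∁q p q) ⟩
    ∣ ⋃[ (p ∩ q) ∪ (p ∩ ∁ q) ] X ∣ + ∣ ⋃[ q ] X ∣
      ≡⟨ cong (λ r → ∣ r ∣ + ∣ ⋃[ q ] X ∣) (⋃-∪ (p ∩ q) (p ∩ ∁ q) X) ⟩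
    ∣ ⋃[ p ∩ q ] X ∪ ⋃[ p ∩ ∁ q ] X ∣ + ∣ ⋃[ q ] X ∣
      ≤⟨ +-monoˡ-≤ ∣ ⋃[ q ] X ∣ (∣p∪q∣≤∣p∣+∣q∣ (⋃[ p ∩ q ] X) _) ⟩
    (∣ ⋃[ p ∩ q ] X ∣ + ∣ ⋃[ p ∩ ∁ q ] X ∣) + ∣ ⋃[ q ] X ∣
      ≡⟨ +-assoc ∣ ⋃[ p ∩ q ] X ∣ _ _ ⟩
    ∣ ⋃[ p ∩ q ] X ∣ + (∣ ⋃[ p ∩ ∁ q ] X ∣ + ∣ ⋃[ q ] X ∣)
      ≤⟨ +-monoʳ-≤ ∣ ⋃[ p ∩ q ] X ∣ (+-mono-≤ (∣⋃∣≤∑∣∣ (p ∩ ∁ q) X) (∣⋃∣≤∑∣∣ q X)) ⟩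
    ∣ ⋃[ p ∩ q ] X ∣ + (∑[ p ∩ ∁ q ] (∣_∣ ∘ X) + ∑[ q ] (∣_∣ ∘ X))
      ≡⟨ cong (∣ ⋃[ p ∩ q ] X ∣ +_) (∑[p∩∁q]+∑[q]≡∑[p∪q] p q (∣_∣ ∘ X)) ⟩
    ∣ ⋃[ p ∩ q ] X ∣ + ∑[ p ∪ q ] (∣_∣ ∘ X)
      ∎
    where open ≤-Reasoning

module _ {n : ℕ} (G : Graph n) where

  nonNeighbours : Fin n → Subset n
  nonNeighbours v = ∁ (N G v)

  nNhat+∣⋃nonNeighbours∣≡n : ∀ S → nNhat G S + ∣ ⋃[ S ] nonNeighbours ∣ ≡ n
  nNhat+∣⋃nonNeighbours∣≡n S =
    trans (cong (λ r → ∣ ∁ r ∣ + ∣ ⋃[ S ] nonNeighbours ∣) (foldr-allFin≡⋃ S nonNeighbours))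
          (∣∁p∣+∣p∣≡n (⋃[ S ] nonNeighbours))

  5*∣nonNeighbours∣<n : MinDegGt4n/5 G → ∀ v → 5 * ∣ nonNeighbours v ∣ < n
  5*∣nonNeighbours∣<n δ>4n/5 v = +-cancelʳ-< (4 * n) (5 * ∣ nonNeighbours v ∣) n (begin-strict
    5 * ∣ nonNeighbours v ∣ + 4 * n            <⟨ +-monoʳ-< (5 * ∣ nonNeighbours v ∣) (δ>4n/5 v) ⟩
    5 * ∣ nonNeighbours v ∣ + 5 * degree G v   ≡⟨ *-distribˡ-+ 5 ∣ nonNeighbours v ∣ (degree G v) ⟨
    5 * (∣ nonNeighbours v ∣ + degree G v)     ≡⟨ cong (5 *_) (∣∁p∣+∣p∣≡n (N G v)) ⟩
    5 * n                                      ∎)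
    where open ≤-Reasoning

  ∑∣nonNeighbours∣<n : MinDegGt4n/5 G → ∀ S → Nonempty S → ∣ S ∣ ≤ 5 →
    ∑[ S ] (∣_∣ ∘ nonNeighbours) < n
  ∑∣nonNeighbours∣<n δ>4n/5 S S≢∅ ∣S∣≤5 = *-cancelˡ-< 5 _ n (begin-strict
    5 * ∑[ S ] (∣_∣ ∘ nonNeighbours)          ≡⟨ *-distribˡ-∑ 5 S (∣_∣ ∘ nonNeighbours) ⟩
    ∑[ S ] (λ v → 5 * ∣ nonNeighbours v ∣)    <⟨ ∑-mono-< S S≢∅ (5*∣nonNeighbours∣<n δ>4n/5) ⟩
    ∑[ S ] const n                            ≡⟨ ∑-const S n ⟩
    ∣ S ∣ * n                                 ≤⟨ *-monoˡ-≤ n ∣S∣≤5 ⟩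
    5 * n                                     ∎)
    where open ≤-Reasoning

lemma3p4 : (n : ℕ) (G : Graph n) → MinDegGt4n/5 G →
    (A B : Subset n) → Nonempty A → Nonempty B → ∣ A ∪ B ∣ ≤ 5 →
    nNhat G (A ∩ B) < nNhat G A + nNhat G B
lemma3p4 n G δ>4n/5 A B (x , x∈A) _ ∣A∪B∣≤5 =
  +-cancelʳ-< (u A + u B) (nNhat G (A ∩ B)) (nNhat G A + nNhat G B) (begin-strict
    nNhat G (A ∩ B) + (u A + u B)          <⟨ +-monoʳ-< (nNhat G (A ∩ B)) union-bound ⟩
    nNhat G (A ∩ B) + (u (A ∩ B) + n)      ≡⟨ +-assoc (nNhat G (A ∩ B)) _ _ ⟨
    (nNhat G (A ∩ B) + u (A ∩ B)) + n      ≡⟨ cong (_+ n) (complement (A ∩ B)) ⟩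
    n + n                                  ≡⟨ cong₂ _+_ (complement A) (complement B) ⟨
    (nNhat G A + u A) + (nNhat G B + u B)  ≡⟨ +-CS.interchange (nNhat G A) (u A) _ _ ⟩
    (nNhat G A + nNhat G B) + (u A + u B)  ∎)
  where
  open ≤-Reasoning
  u : Subset n → ℕ
  u S = ∣ ⋃[ S ] nonNeighbours G ∣
  complement : ∀ S → nNhat G S + u S ≡ n
  complement = nNhat+∣⋃nonNeighbours∣≡n G
  union-bound : u A + u B < u (A ∩ B) + n
  union-bound = ≤-<-trans (∣⋃[p]∣+∣⋃[q]∣≤∣⋃[p∩q]∣+∑[p∪q] A B (nonNeighbours G))
    (+-monoʳ-< (u (A ∩ B)) (∑∣nonNeighbours∣<n G δ>4n/5 (A ∪ B) (x , x∈p∪q⁺ (inj₁ x∈A)) ∣A∪B∣≤5))
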